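{- In the game \textsc{saliquant}, let $p,q$ be odd primes. Then (i) $\mathcal{SG}(2p)\in\left\{p-1,\ \frac{p-1}{2}\right\}$; and (ii) $\mathcal{SG}(2pq)\in\left\{pq-1,\ pq-\frac{p+1}{2},\ pq-\frac{q+1}{2},\ \frac{pq-1}{2}\right\}$.
   Context: \textsc{saliquant} is the normal-play impartial game whose positions are the positive integers, where the options of a position $n\geq 1$ are $\{n-k : 1\leq k\leq n,\ k\nmid n\}$. The nim-value is defined recursively by $\mathcal{SG}(n)=\operatorname{mex}\{\mathcal{SG}(x) : x \text{ an option of } n\}$, where $\operatorname{mex}(A)$ is the least nonnegative integer not in $A$. -}

module Defs where

open import Data.Nat using (ℕ; zero; suc; _∸_; _≡ᵇ_; _<ᵇ_)
open import Data.Nat.Divisibility using (_∣?_)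
open import Data.Bool using (Bool; true; false; if_then_else_; not)
open import Data.List using (List; []; _∷_; length; map; filterᵇ; upTo)
open import Data.Bool.ListAction using (any)
open import Relation.Nullary.Decidable using (⌊_⌋)

elemᵇ : ℕ → List ℕ → Bool
elemᵇ x xs = any (λ y → x ≡ᵇ y) xs

-- mex of a finite list: least natural not in the list.
-- Search candidates m, m+1, ... with fuel; fuel (length xs + 1) always suffices.
mexFrom : ℕ → ℕ → List ℕ → ℕ
mexFrom zero m xs = m
mexFrom (suc fuel) m xs = if elemᵇ m xs then mexFrom fuel (suc m) xs else m

mex : List ℕ → ℕ
mex xs = mexFrom (suc (length xs)) 0 xs

moveSizes : ℕ → List ℕ
moveSizes n = filterᵇ (λ k → not ⌊ k ∣? n ⌋) (map suc (upTo n))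

options : ℕ → List ℕ
options n = map (λ k → n ∸ k) (moveSizes n)

-- sgBelow n m = SG(m) for m < n (values for m ≥ n are junk, never used)
sgBelow : ℕ → ℕ → ℕ
sgBelow zero m = 0
sgBelow (suc n) m =
  if m <ᵇ n then sgBelow n m
  else mex (map (sgBelow n) (options n))

-- the Sprague-Grundy value of SALIQUANT position n (options of n are all < n)
SG : ℕ → ℕ
SG n = sgBelow (suc n) n

open import Relation.Binary.PropositionalEquality using (_≡_; refl)
_ : SG 1 ≡ 0
_ = refl
_ : SG 6 ≡ 1
_ = refl
_ : SG 10 ≡ 2
_ = refl
_ : SG 14 ≡ 6
_ = refl
_ : SG 30 ≡ 13
_ = refl

-- Since 1 divides every position, the options of n are at most n − 2, so 2 SG(n) < n for
-- n ≥ 1. An even move never divides an odd position, so 2j + 1 reaches every smaller odd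
-- position and SG(2j + 1) = j. Now write N = SG(2N) + 1 + r. If 2r + 1 did not divide N, it
-- would not divide 2N either, and the move 2r + 1 would lead from 2N to 2 SG(2N) + 1, a
-- position of the same value. Hence SG(2N) = N − (d + 1)/2 for a divisor d of N; the divisors
-- of p and of pq are known, and for an odd d = N the value is (N − 1)/2.
module Submission where

open import Defs
open import Data.Bool using (true; false; T; T?; not)
open import Data.Bool.Properties using (T-≡)
open import Data.Empty using (⊥)
open import Data.Fin using (Fin; toℕ)
open import Data.Fin.Properties using (toℕ<n; pigeonhole)
open import Data.List using (List; length; map; upTo)
open import Data.List.Membership.Propositional using (_∈_; _∉_)
open import Data.List.Membership.Propositional.Properties
  using (∈-map⁺; ∈-map⁻; ∈-filter⁺; ∈-filter⁻; ∈-upTo⁺; ∈-upTo⁻)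
open import Data.List.Properties using (map-cong-local)
open import Data.List.Relation.Unary.All using (tabulate)
open import Data.List.Relation.Unary.Any using (index)
open import Data.List.Relation.Unary.Any.Properties using (any⁺; any⁻; lookup-index)
open import Data.Nat
open import Data.Nat.Divisibility
open import Data.Nat.DivMod using (m*n/n≡m)
open import Data.Nat.Induction using (<-rec)
open import Data.Nat.Primality using (Prime; prime[2]; prime⇒irreducible; prime⇒nonZero; euclidsLemma)
open import Data.Nat.Coprimality using (Coprime; coprime-divisor)
open import Data.Nat.Properties
open import Data.Nat.Tactic.RingSolver using (solve-∀)
open import Data.Product using (∃₂; ∃-syntax; _×_; _,_)
open import Data.Sum using (_⊎_; inj₁; inj₂)
open import Function using (_∘_)
open import Function.Bundles using (Equivalence)
open import Relation.Nullary using (yes; no; contradiction)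
open import Relation.Nullary.Decidable using (⌊_⌋; toWitnessFalse; fromWitnessFalse)
open import Relation.Binary.PropositionalEquality

private
  variable
    fuel i j m n r v N : ℕ
    xs : List ℕ

T-elemᵇ⇒∈ : T (elemᵇ m xs) → m ∈ xs
T-elemᵇ⇒∈ {m} {xs} t = Data.List.Relation.Unary.Any.map (≡ᵇ⇒≡ m _) (any⁻ _ xs t)

∈⇒T-elemᵇ : m ∈ xs → T (elemᵇ m xs)
∈⇒T-elemᵇ {m} m∈xs = any⁺ _ (Data.List.Relation.Unary.Any.map (≡⇒≡ᵇ m _) m∈xs)

Prefix⊆ : ℕ → List ℕ → Set
Prefix⊆ m xs = ∀ {i} → i < m → i ∈ xs

Prefix⊆-zero : Prefix⊆ 0 xs
Prefix⊆-zero ()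

Prefix⊆-suc : Prefix⊆ m xs → m ∈ xs → Prefix⊆ (suc m) xs
Prefix⊆-suc below m∈xs i<1+m with m≤n⇒m<n∨m≡n (s≤s⁻¹ i<1+m)
... | inj₁ i<m  = below i<m
... | inj₂ refl = m∈xs

Prefix⊆⇒≤length : Prefix⊆ m xs → m ≤ length xs
Prefix⊆⇒≤length {m} {xs} below = ≮⇒≥ λ length<m → collision (pigeonhole length<m position)
  where
  open ≡-Reasoning
  position : Fin m → Fin (length xs)
  position i = index (below (toℕ<n i))
  collision : ∃₂ (λ i j → i Data.Fin.< j × position i ≡ position j) → ⊥
  collision (i , j , i<j , same) = <⇒≢ i<j (begin
    toℕ i                            ≡⟨ lookup-index (below (toℕ<n i)) ⟩
    Data.List.lookup xs (position i) ≡⟨ cong (Data.List.lookup xs) same ⟩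
    Data.List.lookup xs (position j) ≡⟨ lookup-index (below (toℕ<n j)) ⟨
    toℕ j                            ∎)

mexFrom-Prefix⊆ : Prefix⊆ m xs → Prefix⊆ (mexFrom fuel m xs) xs
mexFrom-Prefix⊆ {m} {xs} {zero} below = below
mexFrom-Prefix⊆ {m} {xs} {suc fuel} below with elemᵇ m xs in eq
... | true  = mexFrom-Prefix⊆ {fuel = fuel} (Prefix⊆-suc below (T-elemᵇ⇒∈ (Equivalence.from T-≡ eq)))
... | false = below

mexFrom-∉ : Prefix⊆ m xs → mexFrom fuel m xs ∉ xs ⊎ Prefix⊆ (m + fuel) xs
mexFrom-∉ {m} {xs} {zero} below = inj₂ (below ∘ subst (_ <_) (+-identityʳ m))
mexFrom-∉ {m} {xs} {suc fuel} below with elemᵇ m xs in eq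
... | false = inj₁ λ m∈xs → subst T eq (∈⇒T-elemᵇ m∈xs)
... | true with mexFrom-∉ {fuel = fuel} (Prefix⊆-suc below (T-elemᵇ⇒∈ (Equivalence.from T-≡ eq)))
...   | inj₁ ∉xs  = inj₁ ∉xs
...   | inj₂ full = inj₂ λ {i} i< → full (subst (i <_) (+-suc m fuel) i<)

mex-Prefix⊆ : Prefix⊆ (mex xs) xs
mex-Prefix⊆ {xs} = mexFrom-Prefix⊆ {xs = xs} {fuel = suc (length xs)} Prefix⊆-zero

-- The fuel length xs + 1 can only run out if length xs + 1 distinct values lie in xs.
mex-∉ : mex xs ∉ xs
mex-∉ {xs} with mexFrom-∉ {xs = xs} {fuel = suc (length xs)} Prefix⊆-zero
... | inj₁ ∉xs  = ∉xs
... | inj₂ full = contradiction (Prefix⊆⇒≤length full) (n≮n (length xs))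

IsOption : ℕ → ℕ → Set
IsOption n m = ∃[ k ] m + k ≡ n × 0 < k × k ∤ n

∈options⇒IsOption : m ∈ options n → IsOption n m
∈options⇒IsOption {n = n} m∈
  with k , k∈ , refl ← ∈-map⁻ (n ∸_) m∈
  with k∈sizes , k∤n ← ∈-filter⁻ (λ k → T? (not ⌊ k ∣? n ⌋)) {xs = map suc (upTo n)} k∈
  with j , j∈ , refl ← ∈-map⁻ suc k∈sizes
  = suc j , m∸n+n≡m (∈-upTo⁻ j∈) , z<s , toWitnessFalse k∤n

IsOption⇒∈options : IsOption n m → m ∈ options n
IsOption⇒∈options {n} {m} (suc j , m+k≡n , _ , k∤n) =
  subst (_∈ options n) n∸k≡m (∈-map⁺ (n ∸_)
    (∈-filter⁺ (λ k → T? (not ⌊ k ∣? n ⌋)) (∈-map⁺ suc (∈-upTo⁺ j<n)) (fromWitnessFalse k∤n)))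
  where
  n∸k≡m : n ∸ suc j ≡ m
  n∸k≡m = trans (cong (_∸ suc j) (sym m+k≡n)) (m+n∸n≡m m (suc j))
  j<n : j < n
  j<n = subst (suc j ≤_) m+k≡n (m≤n+m (suc j) m)

IsOption⇒+2≤ : IsOption n m → m + 2 ≤ n
IsOption⇒+2≤ {n} (suc zero , _ , _ , 1∤n) = contradiction (1∣ n) 1∤n
IsOption⇒+2≤ {m = m} (suc (suc k) , m+k≡n , _ , _) = subst (m + 2 ≤_) m+k≡n (+-monoʳ-≤ m (s≤s (s≤s z≤n)))

IsOption⇒0< : IsOption n m → 0 < m
IsOption⇒0< {m = zero}  (k , refl , _ , k∤k) = contradiction ∣-refl k∤k
IsOption⇒0< {m = suc m} _ = z<s

IsOption⇒< : IsOption n m → m < n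
IsOption⇒< {m = m} option = <-≤-trans (m<m+n m z<s) (IsOption⇒+2≤ option)

<ᵇ-irrefl : ∀ n → (n <ᵇ n) ≡ false
<ᵇ-irrefl zero    = refl
<ᵇ-irrefl (suc n) = <ᵇ-irrefl n

SG-unfold : ∀ n → SG n ≡ mex (map (sgBelow n) (options n))
SG-unfold n rewrite <ᵇ-irrefl n = refl

sgBelow-stable : m < n → sgBelow n m ≡ SG m
sgBelow-stable {m} {suc n} m<1+n with m <ᵇ n in eq
... | true  = sgBelow-stable (<ᵇ⇒< m n (Equivalence.from T-≡ eq))
... | false with m≤n⇒m<n∨m≡n (s≤s⁻¹ m<1+n)
...   | inj₁ m<n  = contradiction (<⇒<ᵇ m<n) (subst T eq)
...   | inj₂ refl = sym (SG-unfold m)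

SG-mex : ∀ n → SG n ≡ mex (map SG (options n))
SG-mex n = trans (SG-unfold n)
  (cong mex (map-cong-local (tabulate λ {m} m∈ → sgBelow-stable {m} {n} (IsOption⇒< (∈options⇒IsOption m∈)))))

SG-option-≢ : IsOption n m → SG m ≢ SG n
SG-option-≢ {n} option SGm≡SGn =
  mex-∉ (subst (_∈ map SG (options n)) (trans SGm≡SGn (SG-mex n)) (∈-map⁺ SG (IsOption⇒∈options option)))

SG-attains-below : i < SG n → ∃[ m ] IsOption n m × SG m ≡ i
SG-attains-below {n = n} i<SGn with m , m∈ , refl ← ∈-map⁻ SG (mex-Prefix⊆ (subst (_ <_) (SG-mex n) i<SGn)) =
  m , ∈options⇒IsOption m∈ , refl

2*SG[n]<n : 0 < n → 2 * SG n < n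
2*SG[n]<n {n} = <-rec (λ n → 0 < n → 2 * SG n < n) step n
  where
  step : ∀ n → (∀ {m} → m < n → 0 < m → 2 * SG m < m) → 0 < n → 2 * SG n < n
  step n ih 0<n with SG n | (λ i → SG-attains-below {i} {n})
  ... | zero  | _      = 0<n
  ... | suc w | attain with m , option , refl ← attain w (n<1+n w) = begin-strict
    2 * suc (SG m) ≡⟨ *-suc 2 (SG m) ⟩
    2 + 2 * SG m   <⟨ +-monoʳ-< 2 (ih (IsOption⇒< option) (IsOption⇒0< option)) ⟩
    2 + m          ≡⟨ +-comm 2 m ⟩
    m + 2          ≤⟨ IsOption⇒+2≤ option ⟩
    n              ∎
    where open ≤-Reasoning

even∤odd : ∀ m j → 2 * m ∤ suc (2 * j)
even∤odd m j 2m∣odd with divides q odd≡q*2 ← ∣-trans (m∣m*n m) 2m∣odd =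
  even≢odd q j (trans (*-comm 2 q) (sym odd≡q*2))

odd∣2*n⇒∣n : ∀ r → suc (2 * r) ∣ 2 * n → suc (2 * r) ∣ n
odd∣2*n⇒∣n {n} r d∣2n = ∣m+n∣m⇒∣n (subst (suc (2 * r) ∣_) (split r n) (m∣m*n n)) (∣-trans d∣2n (n∣m*n r))
  where
  split : ∀ r n → suc (2 * r) * n ≡ r * (2 * n) + n
  split = solve-∀

odd-option : v < j → IsOption (suc (2 * j)) (suc (2 * v))
odd-option {v} {j} v<j with e , 1+v+e≡j ← m≤n⇒∃[o]m+o≡n v<j =
  2 * suc e , cong suc (trans (sym (*-distribˡ-+ 2 v (suc e))) (cong (2 *_) (trans (+-suc v e) 1+v+e≡j))) ,
  z<s , even∤odd (suc e) j

SG-odd : ∀ j → SG (suc (2 * j)) ≡ j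
SG-odd = <-rec _ λ j ih → ≤-antisym (SG≤ j) (≮⇒≥ λ v<j → SG-option-≢ (odd-option v<j) (ih v<j))
  where
  SG≤ : ∀ j → SG (suc (2 * j)) ≤ j
  SG≤ j = *-cancelˡ-≤ 2 (s≤s⁻¹ (2*SG[n]<n z<s))

double-option : v + suc r ≡ N → suc (2 * r) ∤ N → IsOption (2 * N) (suc (2 * v))
double-option {v} {r} {N} v+1+r≡N d∤N =
  suc (2 * r) , trans (join v r) (cong (2 *_) v+1+r≡N) , z<s , λ d∣2N → d∤N (odd∣2*n⇒∣n r d∣2N)
  where
  join : ∀ v r → suc (2 * v) + suc (2 * r) ≡ 2 * (v + suc r)
  join = solve-∀

half-odd+1 : ∀ r → (suc (2 * r) + 1) / 2 ≡ suc r
half-odd+1 r = trans (cong (_/ 2) (double r)) (m*n/n≡m (suc r) 2)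
  where
  double : ∀ r → suc (2 * r) + 1 ≡ suc r * 2
  double = solve-∀

SG-double-gap : SG (2 * N) + suc r ≡ N → suc (2 * r) ∣ N
SG-double-gap {N} {r} v+1+r≡N with suc (2 * r) ∣? N
... | yes d∣N = d∣N
... | no  d∤N = contradiction (SG-odd (SG (2 * N))) (SG-option-≢ (double-option v+1+r≡N d∤N))

SG[2N]<N : .{{NonZero N}} → SG (2 * N) < N
SG[2N]<N {N} = *-cancelˡ-< 2 (SG (2 * N)) N (2*SG[n]<n (*-monoʳ-< 2 (>-nonZero⁻¹ N)))

SG-double : .{{NonZero N}} → ∃[ d ] d ∣ N × SG (2 * N) ≡ N ∸ (d + 1) / 2
SG-double {N} with r , 1+v+r≡N ← m≤n⇒∃[o]m+o≡n (SG[2N]<N {N}) =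
  suc (2 * r) , SG-double-gap v+1+r≡N′ , (begin
    SG (2 * N)                 ≡⟨ m+n∸n≡m (SG (2 * N)) (suc r) ⟨
    SG (2 * N) + suc r ∸ suc r ≡⟨ cong (_∸ suc r) v+1+r≡N′ ⟩
    N ∸ suc r                  ≡⟨ cong (N ∸_) (half-odd+1 r) ⟨
    N ∸ (suc (2 * r) + 1) / 2  ∎)
  where
  open ≡-Reasoning
  v+1+r≡N′ : SG (2 * N) + suc r ≡ N
  v+1+r≡N′ = trans (+-suc _ r) 1+v+r≡N

2∤⇒odd : ∀ n → 2 ∤ n → ∃[ a ] n ≡ suc (2 * a)
2∤⇒odd zero          2∤0 = contradiction (2 ∣0) 2∤0
2∤⇒odd (suc zero)    _   = 0 , refl
2∤⇒odd (suc (suc n)) 2∤n+2 with a , refl ← 2∤⇒odd n (2∤n+2 ∘ ∣m∣n⇒∣m+n ∣-refl) =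
  suc a , cong suc (sym (*-suc 2 a))

odd-∸-half : 2 ∤ n → n ∸ (n + 1) / 2 ≡ (n ∸ 1) / 2
odd-∸-half {n} 2∤n with a , refl ← 2∤⇒odd n 2∤n = begin
  suc (2 * a) ∸ (suc (2 * a) + 1) / 2 ≡⟨ cong (suc (2 * a) ∸_) (half-odd+1 a) ⟩
  suc (2 * a) ∸ suc a                 ≡⟨ cong (_∸ suc a) (split a) ⟩
  a + suc a ∸ suc a                   ≡⟨ m+n∸n≡m a (suc a) ⟩
  a                                   ≡⟨ m*n/n≡m a 2 ⟨
  a * 2 / 2                           ≡⟨ cong (_/ 2) (*-comm a 2) ⟩
  2 * a / 2                           ∎
  where
  open ≡-Reasoning
  split : ∀ a → suc (2 * a) ≡ a + suc a
  split = solve-∀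

2∤odd-prime : ∀ {p} → Prime p → p ≢ 2 → 2 ∤ p
2∤odd-prime pp p≢2 2∣p with prime⇒irreducible pp 2∣p
... | inj₂ 2≡p = p≢2 (sym 2≡p)

prime∤⇒coprime : ∀ {p d} → Prime p → p ∤ d → Coprime d p
prime∤⇒coprime pp p∤d (c∣d , c∣p) with prime⇒irreducible pp c∣p
... | inj₁ c≡1  = c≡1
... | inj₂ refl = contradiction c∣d p∤d

divisor-of-prime*prime : ∀ {d} p q → Prime p → Prime q → d ∣ p * q →
  d ≡ 1 ⊎ d ≡ p ⊎ d ≡ q ⊎ d ≡ p * q
divisor-of-prime*prime {d} p q pp qp d∣pq with p ∣? d
... | yes (divides e refl)
  with prime⇒irreducible qp {e} (*-cancelʳ-∣ p {{prime⇒nonZero pp}} (subst (e * p ∣_) (*-comm p q) d∣pq))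
...   | inj₁ refl = inj₂ (inj₁ (+-identityʳ p))
...   | inj₂ refl = inj₂ (inj₂ (inj₂ (*-comm q p)))
divisor-of-prime*prime {d} p q pp qp d∣pq | no p∤d
  with prime⇒irreducible qp (coprime-divisor (prime∤⇒coprime pp p∤d) d∣pq)
...   | inj₁ d≡1 = inj₁ d≡1
...   | inj₂ d≡q = inj₂ (inj₂ (inj₁ d≡q))

SG-2p : ∀ p → Prime p → p ≢ 2 → SG (2 * p) ≡ p ∸ 1 ⊎ SG (2 * p) ≡ (p ∸ 1) / 2
SG-2p p pp p≢2 with d , d∣p , SG≡ ← SG-double {{prime⇒nonZero pp}}
                 | prime⇒irreducible pp d∣p
... | inj₁ refl = inj₁ SG≡
... | inj₂ refl = inj₂ (trans SG≡ (odd-∸-half (2∤odd-prime pp p≢2)))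

SG-2pq : ∀ p q → Prime p → Prime q → p ≢ 2 → q ≢ 2 →
  SG (2 * (p * q)) ≡ p * q ∸ 1
  ⊎ SG (2 * (p * q)) ≡ p * q ∸ (p + 1) / 2
  ⊎ SG (2 * (p * q)) ≡ p * q ∸ (q + 1) / 2
  ⊎ SG (2 * (p * q)) ≡ (p * q ∸ 1) / 2
SG-2pq p q pp qp p≢2 q≢2 with d , d∣pq , SG≡ ← SG-double {{m*n≢0 p q {{prime⇒nonZero pp}} {{prime⇒nonZero qp}}}}
                              | divisor-of-prime*prime p q pp qp d∣pq
... | inj₁ refl                 = inj₁ SG≡
... | inj₂ (inj₁ refl)         = inj₂ (inj₁ SG≡)
... | inj₂ (inj₂ (inj₁ refl))  = inj₂ (inj₂ (inj₁ SG≡))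
... | inj₂ (inj₂ (inj₂ refl))  = inj₂ (inj₂ (inj₂ (trans SG≡ (odd-∸-half 2∤pq))))
  where
  2∤pq : 2 ∤ p * q
  2∤pq 2∣pq with euclidsLemma p q prime[2] 2∣pq
  ... | inj₁ 2∣p = 2∤odd-prime pp p≢2 2∣p
  ... | inj₂ 2∣q = 2∤odd-prime qp q≢2 2∣q

mainTheorem9 : ∀ (p q : ℕ) → Prime p → Prime q → p ≢ 2 → q ≢ 2 →
    (SG (2 * p) ≡ p ∸ 1 ⊎ SG (2 * p) ≡ (p ∸ 1) / 2)
    × (SG (2 * p * q) ≡ p * q ∸ 1
    ⊎ SG (2 * p * q) ≡ p * q ∸ (p + 1) / 2
    ⊎ SG (2 * p * q) ≡ p * q ∸ (q + 1) / 2
    ⊎ SG (2 * p * q) ≡ (p * q ∸ 1) / 2)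
mainTheorem9 p q pp qp p≢2 q≢2 rewrite *-assoc 2 p q =
  SG-2p p pp p≢2 , SG-2pq p q pp qp p≢2 q≢2
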